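{- Let $q$ be a prime power, $n\ge 2$, let $U\subsetneq \mathbb{F}_{q^n}$ be an $\mathbb{F}_q$-vector space of dimension $d_U\ge 1$, and let $G$ be any maximal clique in $G_U$ (a clique not contained in a strictly larger clique), with vertex set $V(G)$. Let $V(G)_2=\{\alpha\in V(G): \alpha^2\in U\}$ and $V(G)_1=V(G)\setminus V(G)_2$. Then: (1) $V(G)_2$ is an $\mathbb{F}_q$-vector space; (2) the elements of $V(G)_1$ are $\mathbb{F}_q$-linearly independent; (3) if $V(G)_1$ is nonempty and $W$ is the $\mathbb{F}_q$-vector space spanned by $V(G)_1$, then $W\cap V(G)_2=\{0\}$. In particular, $\omega(G_U)=q^t+r$ for some integers $t,r\ge 0$ such that either $t=0$ and $r\le d_U+1$, or $t\ge 1$ and $r+t\le d_U$.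
   Context: $\mathbb{F}_{q^n}$ is regarded as an $n$-dimensional vector space over $\mathbb{F}_q$. For an $\mathbb{F}_q$-vector subspace $U\subsetneq \mathbb{F}_{q^n}$, $G_U$ is the undirected graph with vertex set $\mathbb{F}_{q^n}$ in which distinct $a,b$ are adjacent if and only if $ab\in U$; $d_U$ is the $\mathbb{F}_q$-dimension of $U$ and $\omega(G_U)$ is the clique number of $G_U$. -}

module Defs where

open import Level using (0ℓ)
open import Data.Nat using (ℕ; _^_; _≤_)
open import Data.Nat.Primality using (Prime)
open import Data.Product using (Σ; ∃; _×_; _,_)
open import Data.List using (List; length; foldr; zipWith)
open import Data.List.Relation.Unary.All using (All)
open import Relation.Nullary using (¬_)
open import Relation.Binary.PropositionalEquality using (_≡_)
open import Algebra.Bundles using (CommutativeRing)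
import Data.List.Membership.Setoid as SetoidMembership
import Data.List.Relation.Unary.Unique.Setoid as SetoidUnique

IsPrimePower : ℕ → Set
IsPrimePower q = ∃ λ p → ∃ λ k → Prime p × 1 ≤ k × q ≡ p ^ k

module FieldDefs (R : CommutativeRing 0ℓ 0ℓ) where
  open CommutativeRing R
  open SetoidMembership setoid using (_∈_)
  open SetoidUnique setoid using (Unique)

  IsField : Set
  IsField = (¬ 0# ≈ 1#) × (∀ x → ¬ x ≈ 0# → ∃ λ y → x * y ≈ 1#)

  Respects : (Carrier → Set) → Set
  Respects P = ∀ {x y} → x ≈ y → P x → P y

  HasSize : (Carrier → Set) → ℕ → Set
  HasSize P m = ∃ λ (L : List Carrier) →
    length L ≡ m × Unique L × All P L × (∀ x → P x → x ∈ L)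

  IsSubfield : (Carrier → Set) → Set
  IsSubfield S = Respects S × S 0# × S 1#
    × (∀ x y → S x → S y → S (x + y))
    × (∀ x y → S x → S y → S (x * y))
    × (∀ x → S x → S (- x))
    × (∀ x → S x → ¬ x ≈ 0# → ∃ λ y → S y × x * y ≈ 1#)

  IsSubspace : (Carrier → Set) → (Carrier → Set) → Set
  IsSubspace S V = Respects V × V 0#
    × (∀ x y → V x → V y → V (x + y))
    × (∀ c x → S c → V x → V (c * x))

  lincomb : List Carrier → List Carrier → Carrier
  lincomb cs vs = foldr _+_ 0# (zipWith _*_ cs vs)

  LinIndep : (Carrier → Set) → List Carrier → Set
  LinIndep S L = ∀ (cs : List Carrier) → length cs ≡ length L → All S cs →
    lincomb cs L ≈ 0# → All (λ c → c ≈ 0#) cs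

  InSpan : (Carrier → Set) → List Carrier → Carrier → Set
  InSpan S L x = ∃ λ (cs : List Carrier) →
    length cs ≡ length L × All S cs × x ≈ lincomb cs L

  HasDim : (Carrier → Set) → (Carrier → Set) → ℕ → Set
  HasDim S U d = ∃ λ (B : List Carrier) →
    length B ≡ d × All U B × LinIndep S B × (∀ x → U x → InSpan S B x)

  -- cliques of G_U: distinct a, b adjacent iff a * b ∈ U
  IsClique : (Carrier → Set) → List Carrier → Set
  IsClique U C = Unique C × (∀ a b → a ∈ C → b ∈ C → ¬ a ≈ b → U (a * b))

  IsMaximalClique : (Carrier → Set) → List Carrier → Set
  IsMaximalClique U C = IsClique U C ×
    (∀ C′ → IsClique U C′ → (∀ x → x ∈ C → x ∈ C′) → ∀ x → x ∈ C′ → x ∈ C)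

  IsCliqueNumber : (Carrier → Set) → ℕ → Set
  IsCliqueNumber U ω = (∃ λ C → IsClique U C × length C ≡ ω)
    × (∀ C → IsClique U C → length C ≤ ω)

  V₂ : (Carrier → Set) → List Carrier → Carrier → Set
  V₂ U C α = α ∈ C × U (α * α)

  V₁ : (Carrier → Set) → List Carrier → Carrier → Set
  V₁ U C α = α ∈ C × ¬ U (α * α)

{-# OPTIONS --safe #-}

-- A vertex α with α² ∈ U is adjacent to every vertex of C, and
-- maximality puts every common neighbour of C into C; the common neighbours form an
-- F_q-subspace, hence so does V(G)_2. If β · Σ c_γ γ ∈ U for every β of a duplicate-free
-- L ⊆ V(G)_1 (as happens for Σ c_γ γ = 0 and for Σ c_γ γ ∈ V(G)_2), then adjacency of β to
-- the other γ leaves c_β β² ∈ U, and β² ∉ U forces c_β = 0: this gives (2) and (3).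
-- For a clique of maximum size, V(G)_2 has a basis of some size t, so q^t elements.
-- Multiplying V(G)_1 together with that basis by a nonzero α ∈ V(G)_2 (or, when t = 0,
-- the rest of V(G)_1 by one β ∈ V(G)_1) gives an independent subset of U, so r + t ≤ d
-- (or r − 1 ≤ d).

module Submission where

open import Defs
open import Level using (Level; 0ℓ)
open import Function using (_∘_)
import Data.Nat as ℕ
open import Data.Nat using (ℕ; suc; z≤n; s≤s)
import Data.Nat.Properties as ℕₚ
open import Data.Nat.Properties
  using ( n≮n; ≮⇒≥; <⇒≱; ^-monoʳ-<; ≤-antisym; +-suc; suc-injective
        ; m≤m+n; m≤n⇒m⊓n≡m; m+n∸m≡n; ⊓-idem)
open import Data.Product using (∃; ∃₂; _×_; _,_; proj₁; proj₂)
open import Data.Sum using (_⊎_; inj₁; inj₂)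
open import Data.Empty using (⊥-elim)
open import Data.Unit using (⊤; tt)
open import Data.List
  using (List; []; _∷_; [_]; length; map; zipWith; replicate; take; drop; _++_; filter; cartesianProductWith)
open import Data.List.Properties
  using ( length-++; length-map; length-zipWith; length-take; length-drop; length-replicate
        ; take++drop≡id; length-removeAt′)
open import Data.List.Relation.Unary.All as All using (All; []; _∷_)
import Data.List.Relation.Unary.All.Properties as All
open import Data.List.Relation.Unary.Any as Any using (here; there; _─_)
open import Data.List.Relation.Unary.AllPairs as AllPairs using ([]; _∷_)
import Data.List.Membership.Propositional as Prop
import Data.List.Membership.Propositional.Properties as Prop
import Data.List.Membership.Setoid as Membership
import Data.List.Membership.Setoid.Properties as MembershipProps
import Data.List.Relation.Binary.Subset.Setoid as Subset
import Data.List.Relation.Unary.Unique.Setoid as SetoidUnique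
import Data.List.Relation.Unary.Unique.Setoid.Properties as UniqueProps
open import Data.List.Relation.Binary.Disjoint.Setoid using (Disjoint)
open import Relation.Nullary using (¬_; Dec; yes; no; ¬?; _×-dec_)
import Relation.Nullary.Decidable as Dec
open import Relation.Unary using (Pred; Decidable)
import Relation.Binary as Binary
open import Relation.Binary.Bundles using (Setoid)
open import Relation.Binary.PropositionalEquality as ≡ using (_≡_)
open import Algebra.Bundles using (CommutativeRing)
open import Data.List.Extrema.Nat using (argmax; argmax-all; f[xs]≤f[argmax])

private
  variable
    a p : Level
    A : Set a

sublists : List A → List (List A)
sublists []       = [ [] ]
sublists (x ∷ xs) = map (x ∷_) (sublists xs) ++ sublists xs

filter∈sublists : {P : Pred A p} (P? : Decidable P) (xs : List A) →
  filter P? xs Prop.∈ sublists xs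
filter∈sublists P? []       = here ≡.refl
filter∈sublists P? (x ∷ xs) with P? x
... | yes _ = Prop.∈-++⁺ˡ (Prop.∈-map⁺ (x ∷_) (filter∈sublists P? xs))
... | no _  = Prop.∈-++⁺ʳ (map (x ∷_) (sublists xs)) (filter∈sublists P? xs)

length-cartesianProductWith : ∀ {b c} {B : Set b} {C : Set c} (f : A → B → C) xs ys →
  length (cartesianProductWith f xs ys) ≡ length xs ℕ.* length ys
length-cartesianProductWith f []       ys = ≡.refl
length-cartesianProductWith f (x ∷ xs) ys = begin
  length (map (f x) ys ++ cartesianProductWith f xs ys)
    ≡⟨ length-++ (map (f x) ys) ⟩
  length (map (f x) ys) ℕ.+ length (cartesianProductWith f xs ys)
    ≡⟨ ≡.cong₂ ℕ._+_ (length-map (f x) ys) (length-cartesianProductWith f xs ys) ⟩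
  length ys ℕ.+ length xs ℕ.* length ys ∎
  where open ≡.≡-Reasoning

length-filter-partition : {P : Pred A p} (P? : Decidable P) (xs : List A) →
  length xs ≡ length (filter P? xs) ℕ.+ length (filter (¬? ∘ P?) xs)
length-filter-partition P? [] = ≡.refl
length-filter-partition P? (x ∷ xs) with P? x
... | yes _ = ≡.cong suc (length-filter-partition P? xs)
... | no _  = ≡.trans (≡.cong suc (length-filter-partition P? xs)) (≡.sym (+-suc _ _))

module UniqueList {c ℓ} (X : Setoid c ℓ) where
  open Setoid X
  open Membership X using (_∈_)
  open Subset X using (_⊆_)
  open SetoidUnique X using (Unique)

  ∈-─ : ∀ {x y ys} (x∈ys : x ∈ ys) → y ∈ ys → ¬ y ≈ x → y ∈ (ys ─ x∈ys)
  ∈-─ (here x≈z)  (here y≈z)  y≉x = ⊥-elim (y≉x (trans y≈z (sym x≈z)))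
  ∈-─ (here _)    (there y∈)  _   = y∈
  ∈-─ (there _)   (here y≈z)  _   = here y≈z
  ∈-─ (there x∈)  (there y∈)  y≉x = there (∈-─ x∈ y∈ y≉x)

  Unique-length-≤ : ∀ {xs ys} → Unique xs → xs ⊆ ys → length xs ℕ.≤ length ys
  Unique-length-≤ {[]}     _          _  = z≤n
  Unique-length-≤ {x ∷ xs} {ys} (x∉ ∷ u) xs⊆ys =
    ≡.subst (suc (length xs) ℕ.≤_) (≡.sym (length-removeAt′ ys _))
      (s≤s (Unique-length-≤ u λ y∈xs → ∈-─ x∈ys (xs⊆ys (there y∈xs))
        λ y≈x → MembershipProps.All[≉]⇒∉ X x∉ (MembershipProps.∈-resp-≈ X y≈x y∈xs)))
    where
      x∈ys : x ∈ ys
      x∈ys = xs⊆ys (here refl)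

  Unique-length-≡ : ∀ {xs ys} → Unique xs → Unique ys → xs ⊆ ys → ys ⊆ xs →
    length xs ≡ length ys
  Unique-length-≡ uxs uys xs⊆ys ys⊆xs =
    ≤-antisym (Unique-length-≤ uxs xs⊆ys) (Unique-length-≤ uys ys⊆xs)

  ≈-dec-in-Unique : ∀ {xs x y} → Unique xs → x ∈ xs → y ∈ xs → Dec (x ≈ y)
  ≈-dec-in-Unique _ (here x≈z) (here y≈z) = yes (trans x≈z (sym y≈z))
  ≈-dec-in-Unique (z∉ ∷ _) (here x≈z) (there y∈) =
    no λ x≈y → MembershipProps.All[≉]⇒∉ X z∉ (MembershipProps.∈-resp-≈ X (trans (sym x≈y) x≈z) y∈)
  ≈-dec-in-Unique (z∉ ∷ _) (there x∈) (here y≈z) =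
    no λ x≈y → MembershipProps.All[≉]⇒∉ X z∉ (MembershipProps.∈-resp-≈ X (trans x≈y y≈z) x∈)
  ≈-dec-in-Unique (_ ∷ u) (there x∈) (there y∈) = ≈-dec-in-Unique u x∈ y∈

  enumeration⇒≈-decidable : ∀ {xs} → Unique xs → (∀ x → x ∈ xs) → Binary.Decidable _≈_
  enumeration⇒≈-decidable u complete x y = ≈-dec-in-Unique u (complete x) (complete y)

module LinearCombination (R : CommutativeRing 0ℓ 0ℓ) where
  open CommutativeRing R
  open FieldDefs R using (lincomb)
  open import Relation.Binary.Reasoning.Setoid setoid
  open import Algebra.Properties.CommutativeSemigroup +-commutativeSemigroup using (interchange)
  open import Algebra.Properties.CommutativeSemigroup *-commutativeSemigroup using (x∙yz≈y∙xz)

  lincomb-zeroes : ∀ {cs} L → All (_≈ 0#) cs → lincomb cs L ≈ 0#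
  lincomb-zeroes L       []         = refl
  lincomb-zeroes []      (_ ∷ _)    = refl
  lincomb-zeroes {c ∷ cs} (v ∷ L) (c≈0 ∷ cs≈0) = begin
    c * v + lincomb cs L ≈⟨ +-cong (*-cong c≈0 refl) (lincomb-zeroes L cs≈0) ⟩
    0# * v + 0#          ≈⟨ +-identityʳ (0# * v) ⟩
    0# * v               ≈⟨ zeroˡ v ⟩
    0#                   ∎

  *-lincomb : ∀ a cs L → a * lincomb cs L ≈ lincomb (map (a *_) cs) L
  *-lincomb a []       L       = zeroʳ a
  *-lincomb a (c ∷ cs) []      = zeroʳ a
  *-lincomb a (c ∷ cs) (v ∷ L) = begin
    a * (c * v + lincomb cs L)           ≈⟨ distribˡ a (c * v) (lincomb cs L) ⟩
    a * (c * v) + a * lincomb cs L       ≈⟨ +-cong (sym (*-assoc a c v)) (*-lincomb a cs L) ⟩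
    a * c * v + lincomb (map (a *_) cs) L ∎

  lincomb-map-* : ∀ a cs L → lincomb cs (map (a *_) L) ≈ a * lincomb cs L
  lincomb-map-* a []       L       = sym (zeroʳ a)
  lincomb-map-* a (c ∷ cs) []      = sym (zeroʳ a)
  lincomb-map-* a (c ∷ cs) (v ∷ L) = begin
    c * (a * v) + lincomb cs (map (a *_) L) ≈⟨ +-cong (x∙yz≈y∙xz c a v) (lincomb-map-* a cs L) ⟩
    a * (c * v) + a * lincomb cs L          ≈⟨ distribˡ a (c * v) (lincomb cs L) ⟨
    a * (c * v + lincomb cs L)              ∎

  lincomb-+ : ∀ cs ds L → length cs ≡ length ds →
    lincomb cs L + lincomb ds L ≈ lincomb (zipWith _+_ cs ds) L
  lincomb-+ []       []       L       _ = +-identityʳ 0#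
  lincomb-+ (c ∷ cs) (d ∷ ds) []      _ = +-identityʳ 0#
  lincomb-+ (c ∷ cs) (d ∷ ds) (v ∷ L) e = begin
    (c * v + lincomb cs L) + (d * v + lincomb ds L)
      ≈⟨ interchange (c * v) _ (d * v) _ ⟩
    (c * v + d * v) + (lincomb cs L + lincomb ds L)
      ≈⟨ +-cong (sym (distribʳ v c d)) (lincomb-+ cs ds L (suc-injective e)) ⟩
    (c + d) * v + lincomb (zipWith _+_ cs ds) L
      ∎

  lincomb-++ : ∀ cs L₁ L₂ → lincomb cs (L₁ ++ L₂) ≈
    lincomb (take (length L₁) cs) L₁ + lincomb (drop (length L₁) cs) L₂
  lincomb-++ cs       []       L₂ = sym (+-identityˡ _)
  lincomb-++ []       (v ∷ L₁) L₂ = sym (+-identityˡ 0#)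
  lincomb-++ (c ∷ cs) (v ∷ L₁) L₂ = begin
    c * v + lincomb cs (L₁ ++ L₂)         ≈⟨ +-cong refl (lincomb-++ cs L₁ L₂) ⟩
    c * v + (lincomb cs₁ L₁ + lincomb cs₂ L₂) ≈⟨ +-assoc (c * v) _ _ ⟨
    (c * v + lincomb cs₁ L₁) + lincomb cs₂ L₂ ∎
    where
      cs₁ cs₂ : List Carrier
      cs₁ = take (length L₁) cs
      cs₂ = drop (length L₁) cs

module VectorSpace (R : CommutativeRing 0ℓ 0ℓ) {S : CommutativeRing.Carrier R → Set}
            (S-subfield : FieldDefs.IsSubfield R S) where
  open CommutativeRing R
  open FieldDefs R
  open LinearCombination R
  open Membership setoid using (_∈_)
  open SetoidUnique setoid using (Unique)
  open import Relation.Binary.Reasoning.Setoid setoid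
  open import Algebra.Properties.Ring ring
    using ( -1*x≈-x; -‿distribʳ-*; -‿distribˡ-*; -‿+-comm; [y-z]x≈yx-zx
          ; +-inverseˡ-unique; +-inverseʳ-unique; x∙y⁻¹≈ε⇒x≈y; x≈y⇒x∙y⁻¹≈ε)
  open import Algebra.Properties.CommutativeSemigroup +-commutativeSemigroup using (interchange)

  inverse-cancel : ∀ {c d} x → c * d ≈ 1# → d * (c * x) ≈ x
  inverse-cancel {c} {d} x cd≈1 = begin
    d * (c * x) ≈⟨ *-assoc d c x ⟨
    d * c * x   ≈⟨ *-cong (trans (*-comm d c) cd≈1) refl ⟩
    1# * x      ≈⟨ *-identityˡ x ⟩
    x           ∎

  S-resp : Respects S
  S-resp = proj₁ S-subfield

  S-0 : S 0#
  S-0 = proj₁ (proj₂ S-subfield)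

  S-1 : S 1#
  S-1 = proj₁ (proj₂ (proj₂ S-subfield))

  S-+ : ∀ {c d} → S c → S d → S (c + d)
  S-+ = proj₁ (proj₂ (proj₂ (proj₂ S-subfield))) _ _

  S-* : ∀ {c d} → S c → S d → S (c * d)
  S-* = proj₁ (proj₂ (proj₂ (proj₂ (proj₂ S-subfield)))) _ _

  S-neg : ∀ {c} → S c → S (- c)
  S-neg = proj₁ (proj₂ (proj₂ (proj₂ (proj₂ (proj₂ S-subfield))))) _

  S-inverse : ∀ {c} → S c → ¬ c ≈ 0# → ∃ λ d → S d × c * d ≈ 1#
  S-inverse = proj₂ (proj₂ (proj₂ (proj₂ (proj₂ (proj₂ S-subfield))))) _

  module Subspace {V : Carrier → Set} (V-subspace : IsSubspace S V) where

    resp : Respects V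
    resp = proj₁ V-subspace

    0∈ : V 0#
    0∈ = proj₁ (proj₂ V-subspace)

    +-closed : ∀ {x y} → V x → V y → V (x + y)
    +-closed = proj₁ (proj₂ (proj₂ V-subspace)) _ _

    *-closed : ∀ {c x} → S c → V x → V (c * x)
    *-closed = proj₂ (proj₂ (proj₂ V-subspace)) _ _

    -‿closed : ∀ {x} → V x → V (- x)
    -‿closed {x} Vx = resp (-1*x≈-x x) (*-closed (S-neg S-1) Vx)

    +-cancelʳ-closed : ∀ {x y} → V (x + y) → V y → V x
    +-cancelʳ-closed {x} {y} Vx+y Vy = resp x+y-y≈x (+-closed Vx+y (-‿closed Vy))
      where
        x+y-y≈x : x + y + - y ≈ x
        x+y-y≈x = begin
          x + y + - y   ≈⟨ +-assoc x y (- y) ⟩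
          x + (y + - y) ≈⟨ +-cong refl (-‿inverseʳ y) ⟩
          x + 0#        ≈⟨ +-identityʳ x ⟩
          x             ∎

    lincomb-closed : ∀ {cs L} → All S cs → All V L → V (lincomb cs L)
    lincomb-closed []         _          = 0∈
    lincomb-closed (_ ∷ _)    []         = 0∈
    lincomb-closed (Sc ∷ Scs) (Vv ∷ VL) = +-closed (*-closed Sc Vv) (lincomb-closed Scs VL)

    span⊆ : ∀ {B x} → All V B → InSpan S B x → V x
    span⊆ B⊆V (_ , _ , Scs , x≈) = resp (sym x≈) (lincomb-closed Scs B⊆V)

  InSpan-resp : ∀ {L} → Respects (InSpan S L)
  InSpan-resp x≈y (cs , len , Scs , x≈) = cs , len , Scs , trans (sym x≈y) x≈

  InSpan-lincomb : ∀ {cs L} → length cs ≡ length L → All S cs → InSpan S L (lincomb cs L)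
  InSpan-lincomb len Scs = _ , len , Scs , refl

  InSpan-∷ : ∀ {b c y L} → S c → InSpan S L y → InSpan S (b ∷ L) (c * b + y)
  InSpan-∷ Sc (cs , len , Scs , y≈) = _ ∷ cs , ≡.cong suc len , Sc ∷ Scs , +-cong refl y≈

  InSpan-∷⁻ : ∀ {b x L} → InSpan S (b ∷ L) x →
    ∃₂ λ c y → S c × InSpan S L y × x ≈ c * b + y
  InSpan-∷⁻ (c ∷ cs , len , Sc ∷ Scs , x≈) =
    c , lincomb cs _ , Sc , InSpan-lincomb (suc-injective len) Scs , x≈

  private
    S-zipWith-+ : ∀ {cs ds} → All S cs → All S ds → All S (zipWith _+_ cs ds)
    S-zipWith-+ []         _          = []
    S-zipWith-+ (_ ∷ _)    []         = []
    S-zipWith-+ (Sc ∷ Scs) (Sd ∷ Sds) = S-+ Sc Sd ∷ S-zipWith-+ Scs Sds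

  InSpan-isSubspace : ∀ L → IsSubspace S (InSpan S L)
  InSpan-isSubspace L = InSpan-resp , zero∈ , +-closed , *-closed
    where
      zero∈ : InSpan S L 0#
      zero∈ = replicate (length L) 0# , length-replicate (length L) ,
        All.replicate⁺ (length L) S-0 ,
        sym (lincomb-zeroes L (All.replicate⁺ (length L) refl))

      +-closed : ∀ x y → InSpan S L x → InSpan S L y → InSpan S L (x + y)
      +-closed x y (cs , len , Scs , x≈) (ds , len′ , Sds , y≈) =
        zipWith _+_ cs ds ,
        ≡.trans (length-zipWith _+_ cs ds)
          (≡.trans (≡.cong₂ ℕ._⊓_ len len′) (⊓-idem (length L))) ,
        S-zipWith-+ Scs Sds ,
        trans (+-cong x≈ y≈) (lincomb-+ cs ds L (≡.trans len (≡.sym len′)))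

      *-closed : ∀ c x → S c → InSpan S L x → InSpan S L (c * x)
      *-closed c x Sc (cs , len , Scs , x≈) =
        map (c *_) cs , ≡.trans (length-map (c *_) cs) len ,
        All.map⁺ (All.map (S-* Sc) Scs) ,
        trans (*-cong refl x≈) (*-lincomb c cs L)

  module Span (L : List Carrier) = Subspace (InSpan-isSubspace L)

  InSpan-weaken : ∀ {b y L} → InSpan S L y → InSpan S (b ∷ L) y
  InSpan-weaken {b} {y} y∈ = InSpan-resp (trans (+-cong (zeroˡ b) refl) (+-identityˡ y)) (InSpan-∷ S-0 y∈)

  ∈⇒InSpan : ∀ {x L} → x ∈ L → InSpan S L x
  ∈⇒InSpan {x} {v ∷ L} (here x≈v) = InSpan-resp 1*v+0≈x (InSpan-∷ S-1 (Span.0∈ L))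
    where
      1*v+0≈x : 1# * v + 0# ≈ x
      1*v+0≈x = trans (+-identityʳ _) (trans (*-identityˡ v) (sym x≈v))
  ∈⇒InSpan (there x∈L) = InSpan-weaken (∈⇒InSpan x∈L)

  InSpan-dedup : Binary.Decidable _≈_ → ∀ {P : Carrier → Set} L → All P L →
    ∃ λ L′ → Unique L′ × All P L′ × (∀ {x} → InSpan S L x → InSpan S L′ x)
  InSpan-dedup _≟_ []      []         = [] , [] , [] , λ x∈ → x∈
  InSpan-dedup _≟_ (β ∷ L) (Pβ ∷ PL) with InSpan-dedup _≟_ L PL
  ... | L′ , L′-unique , PL′ , spanL⊆spanL′ with Any.any? (β ≟_) L′
  ...   | yes β∈L′ = L′ , L′-unique , PL′ , λ x∈ →
            let c , y , Sc , y∈ , x≈ = InSpan-∷⁻ x∈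
            in InSpan-resp (sym x≈)
                 (Span.+-closed L′ (Span.*-closed L′ Sc (∈⇒InSpan β∈L′)) (spanL⊆spanL′ y∈))
  ...   | no β∉L′ = β ∷ L′ , MembershipProps.∉⇒All[≉] setoid β∉L′ ∷ L′-unique , Pβ ∷ PL′ ,
            λ x∈ → let c , y , Sc , y∈ , x≈ = InSpan-∷⁻ x∈
                   in InSpan-resp (sym x≈) (InSpan-∷ Sc (spanL⊆spanL′ y∈))

  LinIndep-[] : LinIndep S []
  LinIndep-[] [] _ _ _ = []

  LinIndep-tail : ∀ {b L} → LinIndep S (b ∷ L) → LinIndep S L
  LinIndep-tail {b} ind cs len Scs cs·L≈0 =
    All.tail (ind (0# ∷ cs) (≡.cong suc len) (S-0 ∷ Scs)
      (trans (+-cong (zeroˡ b) cs·L≈0) (+-identityʳ 0#)))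

  LinIndep-head-≉0 : ∀ {b L} → ¬ 0# ≈ 1# → LinIndep S (b ∷ L) → ¬ b ≈ 0#
  LinIndep-head-≉0 {b} {L} 0≉1 ind b≈0 =
    0≉1 (sym (All.head (ind (1# ∷ zeros) (≡.cong suc (length-replicate (length L)))
                            (S-1 ∷ All.replicate⁺ (length L) S-0) 1*b+0≈0)))
    where
      zeros : List Carrier
      zeros = replicate (length L) 0#
      1*b+0≈0 : 1# * b + lincomb zeros L ≈ 0#
      1*b+0≈0 = trans (+-cong (trans (*-identityˡ b) b≈0)
                              (lincomb-zeroes L (All.replicate⁺ (length L) refl)))
                      (+-identityʳ 0#)

  LinIndep-∷ : Binary.Decidable _≈_ → ∀ {b L} → LinIndep S L → ¬ InSpan S L b → LinIndep S (b ∷ L)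
  LinIndep-∷ _≟_ {b} {L} ind b∉span (c ∷ cs) len (Sc ∷ Scs) cb+x≈0 with c ≟ 0#
  ... | yes c≈0 = c≈0 ∷ ind cs (suc-injective len) Scs x≈0
    where
      x≈0 : lincomb cs L ≈ 0#
      x≈0 = begin
        lincomb cs L           ≈⟨ +-identityˡ _ ⟨
        0# + lincomb cs L      ≈⟨ +-cong (trans (*-cong c≈0 refl) (zeroˡ b)) refl ⟨
        c * b + lincomb cs L   ≈⟨ cb+x≈0 ⟩
        0#                     ∎
  ... | no c≉0 with S-inverse Sc c≉0
  ...   | d , Sd , cd≈1 = ⊥-elim (b∉span (InSpan-resp b≈ (Span.*-closed L (S-neg Sd)
                             (InSpan-lincomb (suc-injective len) Scs))))
    where
      x : Carrier
      x = lincomb cs L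
      b≈ : - d * x ≈ b
      b≈ = sym (begin
        b             ≈⟨ inverse-cancel b cd≈1 ⟨
        d * (c * b)   ≈⟨ *-cong refl (+-inverseˡ-unique (c * b) x cb+x≈0) ⟩
        d * - x       ≈⟨ -‿distribʳ-* d x ⟨
        - (d * x)     ≈⟨ -‿distribˡ-* d x ⟩
        - d * x       ∎)

  x≉0∧x*y≈0⇒y≈0 : IsField → ∀ {x y} → ¬ x ≈ 0# → x * y ≈ 0# → y ≈ 0#
  x≉0∧x*y≈0⇒y≈0 (_ , inverse) {x} {y} x≉0 xy≈0 with inverse x x≉0
  ... | z , xz≈1 = begin
    y             ≈⟨ inverse-cancel y xz≈1 ⟨
    z * (x * y)   ≈⟨ *-cong refl xy≈0 ⟩
    z * 0#        ≈⟨ zeroʳ z ⟩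
    0#            ∎

  LinIndep-map-* : IsField → ∀ {a L} → ¬ a ≈ 0# → LinIndep S L → LinIndep S (map (a *_) L)
  LinIndep-map-* isField {a} {L} a≉0 ind cs len Scs cs·aL≈0 =
    ind cs (≡.trans len (length-map (a *_) L)) Scs
      (x≉0∧x*y≈0⇒y≈0 isField a≉0 (trans (sym (lincomb-map-* a cs L)) cs·aL≈0))

  LinIndep-++ : ∀ {L₁ L₂} → LinIndep S L₁ → LinIndep S L₂ →
    (∀ {x} → InSpan S L₁ x → InSpan S L₂ x → x ≈ 0#) → LinIndep S (L₁ ++ L₂)
  LinIndep-++ {L₁} {L₂} ind₁ ind₂ disjoint cs len Scs cs·L≈0 =
    ≡.subst (All (_≈ 0#)) (take++drop≡id n cs)
      (All.++⁺ (ind₁ cs₁ len₁ (All.take⁺ n Scs) x₁≈0) (ind₂ cs₂ len₂ (All.drop⁺ n Scs) x₂≈0))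
    where
      n : ℕ
      n = length L₁
      cs₁ cs₂ : List Carrier
      cs₁ = take n cs
      cs₂ = drop n cs
      x₁ x₂ : Carrier
      x₁ = lincomb cs₁ L₁
      x₂ = lincomb cs₂ L₂
      len′ : length cs ≡ n ℕ.+ length L₂
      len′ = ≡.trans len (length-++ L₁)
      len₁ : length cs₁ ≡ n
      len₁ = ≡.trans (length-take n cs) (≡.trans (≡.cong (n ℕ.⊓_) len′) (m≤n⇒m⊓n≡m (m≤m+n n _)))
      len₂ : length cs₂ ≡ length L₂
      len₂ = ≡.trans (length-drop n cs) (≡.trans (≡.cong (ℕ._∸ n) len′) (m+n∸m≡n n _))
      x₁+x₂≈0 : x₁ + x₂ ≈ 0#
      x₁+x₂≈0 = trans (sym (lincomb-++ cs L₁ L₂)) cs·L≈0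
      x₂≈0 : x₂ ≈ 0#
      x₂≈0 = disjoint
        (InSpan-resp (sym (+-inverseʳ-unique x₁ x₂ x₁+x₂≈0))
          (Span.-‿closed L₁ (InSpan-lincomb len₁ (All.take⁺ n Scs))))
        (InSpan-lincomb len₂ (All.drop⁺ n Scs))
      x₁≈0 : x₁ ≈ 0#
      x₁≈0 = begin
        x₁       ≈⟨ +-identityʳ x₁ ⟨
        x₁ + 0#  ≈⟨ +-cong refl x₂≈0 ⟨
        x₁ + x₂  ≈⟨ x₁+x₂≈0 ⟩
        0#       ∎

  LinIndep-head-coefficient-unique : ∀ {b L c c′ y y′} → LinIndep S (b ∷ L) → S c → S c′ →
    InSpan S L y → InSpan S L y′ → c * b + y ≈ c′ * b + y′ → c ≈ c′
  LinIndep-head-coefficient-unique {b} {L} {c} {c′} {y} {y′} ind Sc Sc′ y∈ y′∈ eq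
    with Span.+-closed L y∈ (Span.-‿closed L y′∈)
  ... | es , len , Ses , y-y′≈ =
    x∙y⁻¹≈ε⇒x≈y c c′
      (All.head (ind (c - c′ ∷ es) (≡.cong suc len) (S-+ Sc (S-neg Sc′) ∷ Ses) difference≈0))
    where
      difference≈0 : (c - c′) * b + lincomb es L ≈ 0#
      difference≈0 = begin
        (c - c′) * b + lincomb es L           ≈⟨ +-cong ([y-z]x≈yx-zx b c c′) (sym y-y′≈) ⟩
        (c * b - c′ * b) + (y - y′)           ≈⟨ interchange (c * b) (- (c′ * b)) y (- y′) ⟩
        (c * b + y) + (- (c′ * b) + - y′)     ≈⟨ +-cong refl (-‿+-comm (c′ * b) y′) ⟩
        (c * b + y) - (c′ * b + y′)           ≈⟨ x≈y⇒x∙y⁻¹≈ε eq ⟩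
        0#                                    ∎

module FiniteSpan (R : CommutativeRing 0ℓ 0ℓ) {S : CommutativeRing.Carrier R → Set}
                  (S-subfield : FieldDefs.IsSubfield R S) {Sl : List (CommutativeRing.Carrier R)}
                  (Sl-unique : SetoidUnique.Unique (CommutativeRing.setoid R) Sl) (Sl⊆S : All S Sl)
                  (S⊆Sl : ∀ x → S x → Membership._∈_ (CommutativeRing.setoid R) x Sl) where
  open CommutativeRing R
  open FieldDefs R
  open VectorSpace R S-subfield
  open Membership setoid using (_∈_)
  open SetoidUnique setoid using (Unique)
  open import Algebra.Properties.Ring ring using (+-cancelˡ)

  spanList : List Carrier → List Carrier
  spanList []      = [ 0# ]
  spanList (b ∷ B) = cartesianProductWith (λ c y → c * b + y) Sl (spanList B)

  length-spanList : ∀ B → length (spanList B) ≡ length Sl ℕ.^ length B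
  length-spanList []      = ≡.refl
  length-spanList (b ∷ B) = ≡.trans (length-cartesianProductWith _ Sl (spanList B))
                                    (≡.cong (length Sl ℕ.*_) (length-spanList B))

  ∈-spanList⁻ : ∀ {x} B → x ∈ spanList B → InSpan S B x
  ∈-spanList⁻ []      (here x≈0) = InSpan-resp (sym x≈0) (Span.0∈ [])
  ∈-spanList⁻ (b ∷ B) x∈ with MembershipProps.∈-cartesianProductWith⁻ setoid setoid setoid _ Sl (spanList B) x∈
  ... | c , y , c∈Sl , y∈ , x≈ =
    InSpan-resp (sym x≈) (InSpan-∷ (All.lookupₛ setoid S-resp Sl⊆S c∈Sl) (∈-spanList⁻ B y∈))

  ∈-spanList⁺ : ∀ {x} B → InSpan S B x → x ∈ spanList B
  ∈-spanList⁺ []      ([] , _ , _ , x≈0) = here x≈0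
  ∈-spanList⁺ (b ∷ B) x∈ with InSpan-∷⁻ x∈
  ... | c , y , Sc , y∈ , x≈ = MembershipProps.∈-resp-≈ setoid (sym x≈)
    (MembershipProps.∈-cartesianProductWith⁺ setoid setoid setoid (λ c≈ y≈ → +-cong (*-cong c≈ refl) y≈)
      (S⊆Sl c Sc) (∈-spanList⁺ B y∈))

  spanList-unique : ∀ {B} → LinIndep S B → Unique (spanList B)
  spanList-unique {[]}    _   = [] ∷ []
  spanList-unique {b ∷ B} ind = unique Sl-unique Sl⊆S
    where
      f : Carrier → Carrier → Carrier
      f c y = c * b + y

      unique : ∀ {cs} → Unique cs → All S cs → Unique (cartesianProductWith f cs (spanList B))
      unique []         []         = []
      unique {c ∷ cs} (c∉cs ∷ cs-unique) (Sc ∷ Scs) =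
        UniqueProps.++⁺ setoid
          (UniqueProps.map⁺ setoid setoid (+-cancelˡ (c * b) _ _) (spanList-unique (LinIndep-tail ind)))
          (unique cs-unique Scs) disjoint
        where
          disjoint : Disjoint setoid (map (f c) (spanList B)) (cartesianProductWith f cs (spanList B))
          disjoint (v∈map , v∈product)
            with MembershipProps.∈-map⁻ setoid setoid v∈map
               | MembershipProps.∈-cartesianProductWith⁻ setoid setoid setoid f cs (spanList B) v∈product
          ... | y , y∈ , v≈ | c′ , y′ , c′∈cs , y′∈ , v≈′ =
            MembershipProps.All[≉]⇒∉ setoid c∉cs (MembershipProps.∈-resp-≈ setoid (sym c≈c′) c′∈cs)
            where
              c≈c′ : c ≈ c′
              c≈c′ = LinIndep-head-coefficient-unique ind Sc (All.lookupₛ setoid S-resp Scs c′∈cs)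
                       (∈-spanList⁻ B y∈) (∈-spanList⁻ B y′∈) (trans (sym v≈) v≈′)

  InSpan? : Binary.Decidable _≈_ → ∀ B → Decidable (InSpan S B)
  InSpan? _≟_ B x with Any.any? (x ≟_) (spanList B)
  ... | yes x∈ = yes (∈-spanList⁻ B x∈)
  ... | no x∉  = no (x∉ ∘ ∈-spanList⁺ B)

  spanned-decidable : Binary.Decidable _≈_ → ∀ {V B} → IsSubspace S V → All V B →
    (∀ x → V x → InSpan S B x) → Decidable V
  spanned-decidable _≟_ {V} {B} V-subspace B⊆V V⊆span x =
    Dec.map′ (Subspace.span⊆ V-subspace B⊆V) (V⊆span x) (InSpan? _≟_ B x)

  private
    ^-cancelʳ-≤ : ∀ {q m n} → 2 ℕ.≤ q → q ℕ.^ m ℕ.≤ q ℕ.^ n → m ℕ.≤ n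
    ^-cancelʳ-≤ {q} 2≤q qᵐ≤qⁿ = ≮⇒≥ λ n<m → <⇒≱ (^-monoʳ-< q 2≤q n<m) qᵐ≤qⁿ

  LinIndep-length-≤ : ¬ 0# ≈ 1# → ∀ {L B} → LinIndep S L → All (InSpan S B) L → length L ℕ.≤ length B
  LinIndep-length-≤ 0≉1 {L} {B} ind L⊆span = ^-cancelʳ-≤ 2≤q
    (≡.subst₂ ℕ._≤_ (length-spanList L) (length-spanList B)
      (UniqueList.Unique-length-≤ setoid (spanList-unique ind)
        λ x∈ → ∈-spanList⁺ B (Span.span⊆ B L⊆span (∈-spanList⁻ L x∈))))
    where
      2≤q : 2 ℕ.≤ length Sl
      2≤q = UniqueList.Unique-length-≤ setoid {0# ∷ 1# ∷ []} ((0≉1 ∷ []) ∷ [] ∷ [])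
        λ { (here x≈0)         → MembershipProps.∈-resp-≈ setoid (sym x≈0) (S⊆Sl 0# S-0)
          ; (there (here x≈1)) → MembershipProps.∈-resp-≈ setoid (sym x≈1) (S⊆Sl 1# S-1) }

  extract-basis : Binary.Decidable _≈_ → ∀ {P : Carrier → Set} xs → All P xs →
    ∃ λ B → LinIndep S B × All P B × All (InSpan S B) xs
  extract-basis _≟_ []       []         = [] , LinIndep-[] , [] , []
  extract-basis _≟_ (x ∷ xs) (Px ∷ Pxs) with extract-basis _≟_ xs Pxs
  ... | B , ind , PB , xs⊆span with InSpan? _≟_ B x
  ...   | yes x∈span = B , ind , PB , x∈span ∷ xs⊆span
  ...   | no x∉span  = x ∷ B , LinIndep-∷ _≟_ ind x∉span , Px ∷ PB ,
                       ∈⇒InSpan (here refl) ∷ All.map InSpan-weaken xs⊆span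

module Cliques (R : CommutativeRing 0ℓ 0ℓ) {S : CommutativeRing.Carrier R → Set}
               (S-subfield : FieldDefs.IsSubfield R S) {U : CommutativeRing.Carrier R → Set}
               (U-subspace : FieldDefs.IsSubspace R S U)
               (_≟_ : Binary.Decidable (CommutativeRing._≈_ R)) where
  open CommutativeRing R
  open FieldDefs R
  open LinearCombination R
  open VectorSpace R S-subfield
  open Membership setoid using (_∈_)
  open SetoidUnique setoid using (Unique)
  open import Algebra.Properties.CommutativeSemigroup *-commutativeSemigroup using (x∙yz≈y∙xz)
  module U = Subspace U-subspace

  AdjacentToAll : List Carrier → Carrier → Set
  AdjacentToAll C α = ∀ {γ} → γ ∈ C → U (α * γ)

  AdjacentToAll-isSubspace : ∀ C → IsSubspace S (AdjacentToAll C)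
  AdjacentToAll-isSubspace C =
      (λ x≈y adj γ∈C → U.resp (*-cong x≈y refl) (adj γ∈C))
    , (λ {γ} _ → U.resp (sym (zeroˡ γ)) U.0∈)
    , (λ x y adjx adjy {γ} γ∈C → U.resp (sym (distribʳ γ x y)) (U.+-closed (adjx γ∈C) (adjy γ∈C)))
    , (λ c x Sc adj {γ} γ∈C → U.resp (sym (*-assoc c x γ)) (U.*-closed Sc (adj γ∈C)))

  V₂⇒AdjacentToAll : ∀ {C α} → IsClique U C → V₂ U C α → AdjacentToAll C α
  V₂⇒AdjacentToAll {C} {α} (_ , adjacent) (α∈C , Uαα) {γ} γ∈C with α ≟ γ
  ... | yes α≈γ = U.resp (*-cong refl α≈γ) Uαα
  ... | no α≉γ  = adjacent α γ α∈C γ∈C α≉γ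

  clique-adjacent : ∀ {C β L} → IsClique U C → β ∈ C → All (λ γ → ¬ β ≈ γ) L → All (_∈ C) L →
    All (λ γ → U (β * γ)) L
  clique-adjacent (_ , adjacent) β∈C β≉L L⊆C =
    All.zipWith (λ { (β≉γ , γ∈C) → adjacent _ _ β∈C γ∈C β≉γ }) (β≉L , L⊆C)

  maximal-absorbs : ∀ {C y} → IsMaximalClique U C → AdjacentToAll C y → y ∈ C
  maximal-absorbs {C} {y} ((C-unique , adjacent) , maximal) y-adj with Any.any? (y ≟_) C
  ... | yes y∈C = y∈C
  ... | no y∉C  = maximal (y ∷ C) (MembershipProps.∉⇒All[≉] setoid y∉C ∷ C-unique , adjacent′)
                    (λ _ → there) y (here refl)
    where
      adjacent′ : ∀ a b → a ∈ y ∷ C → b ∈ y ∷ C → ¬ a ≈ b → U (a * b)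
      adjacent′ a b (here a≈y)  (here b≈y)  a≉b = ⊥-elim (a≉b (trans a≈y (sym b≈y)))
      adjacent′ a b (here a≈y)  (there b∈C) _   = U.resp (*-cong (sym a≈y) refl) (y-adj b∈C)
      adjacent′ a b (there a∈C) (here b≈y)  _   = U.resp (trans (*-comm y a) (*-cong refl (sym b≈y))) (y-adj a∈C)
      adjacent′ a b (there a∈C) (there b∈C) a≉b = adjacent a b a∈C b∈C a≉b

  AdjacentToAll⇒V₂ : ∀ {C α} → IsMaximalClique U C → AdjacentToAll C α → V₂ U C α
  AdjacentToAll⇒V₂ maximal adj = maximal-absorbs maximal adj , adj (maximal-absorbs maximal adj)

  V₂-isSubspace : ∀ {C} → IsMaximalClique U C → IsSubspace S (V₂ U C)
  V₂-isSubspace {C} maximal@(clique , _) =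
      (λ x≈y (x∈C , Uxx) → MembershipProps.∈-resp-≈ setoid x≈y x∈C , U.resp (*-cong x≈y x≈y) Uxx)
    , AdjacentToAll⇒V₂ maximal Adj.0∈
    , (λ _ _ V₂x V₂y → AdjacentToAll⇒V₂ maximal
                          (Adj.+-closed (V₂⇒AdjacentToAll clique V₂x) (V₂⇒AdjacentToAll clique V₂y)))
    , (λ _ _ Sc V₂x → AdjacentToAll⇒V₂ maximal (Adj.*-closed Sc (V₂⇒AdjacentToAll clique V₂x)))
    where module Adj = Subspace (AdjacentToAll-isSubspace C)

  V₁-coefficients-vanish : ∀ {C L cs} → IsClique U C → Unique L → All (V₁ U C) L →
    length cs ≡ length L → All S cs → All (λ β → U (β * lincomb cs L)) L → All (_≈ 0#) cs
  V₁-coefficients-vanish {L = []} {[]} _ _ _ _ _ _ = []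
  V₁-coefficients-vanish {C} {β ∷ L} {c ∷ cs} clique (β∉L ∷ L-unique) ((β∈C , ββ∉U) ∷ V₁L)
                         len (Sc ∷ Scs) (U-βx ∷ U-Lx) =
    c≈0 ∷ V₁-coefficients-vanish clique L-unique V₁L (suc-injective len) Scs
            (All.map (U.resp (*-cong refl x≈x′)) U-Lx)
    where
      x′ : Carrier
      x′ = lincomb cs L

      U-βx′ : U (β * x′)
      U-βx′ = U.resp (lincomb-map-* β cs L)
        (U.lincomb-closed Scs (All.map⁺ (clique-adjacent clique β∈C β∉L (All.map proj₁ V₁L))))

      U-cββ : U (c * (β * β))
      U-cββ = U.+-cancelʳ-closed (U.resp βx≈ U-βx) U-βx′
        where
          βx≈ : β * (c * β + x′) ≈ c * (β * β) + β * x′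
          βx≈ = trans (distribˡ β (c * β) x′) (+-cong (x∙yz≈y∙xz β c β) refl)

      c≈0 : c ≈ 0#
      c≈0 with c ≟ 0#
      ... | yes c≈0 = c≈0
      ... | no c≉0 with S-inverse Sc c≉0
      ...   | d , Sd , cd≈1 = ⊥-elim (ββ∉U (U.resp (inverse-cancel (β * β) cd≈1) (U.*-closed Sd U-cββ)))

      x≈x′ : c * β + x′ ≈ x′
      x≈x′ = trans (+-cong (trans (*-cong c≈0 refl) (zeroˡ β)) refl) (+-identityˡ x′)

  V₁-linIndep : ∀ {C L} → IsClique U C → Unique L → All (V₁ U C) L → LinIndep S L
  V₁-linIndep clique L-unique V₁L cs len Scs x≈0 =
    V₁-coefficients-vanish clique L-unique V₁L len Scs
      (All.tabulate λ {β} _ → U.resp (sym (trans (*-cong refl x≈0) (zeroʳ β))) U.0∈)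

  V₁-span∩V₂≈0 : ∀ {C L x} → IsClique U C → All (V₁ U C) L → InSpan S L x → V₂ U C x → x ≈ 0#
  V₁-span∩V₂≈0 {x = x} clique V₁L x∈span V₂x with InSpan-dedup _≟_ _ V₁L
  ... | L′ , L′-unique , V₁L′ , spanL⊆spanL′ with spanL⊆spanL′ x∈span
  ...   | cs , len , Scs , x≈ = trans x≈ (lincomb-zeroes L′
          (V₁-coefficients-vanish clique L′-unique V₁L′ len Scs
            (All.map (λ { {β} (β∈C , _) → U.resp (trans (*-comm x β) (*-cong refl x≈))
                                                   (V₂⇒AdjacentToAll clique V₂x β∈C) }) V₁L′)))

module MaximumClique (R : CommutativeRing 0ℓ 0ℓ) {U : CommutativeRing.Carrier R → Set}
                     (U-resp : FieldDefs.Respects R U) (U? : Decidable U)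
                     (_≟_ : Binary.Decidable (CommutativeRing._≈_ R))
                     {F : List (CommutativeRing.Carrier R)} (F-unique : SetoidUnique.Unique (CommutativeRing.setoid R) F)
                     (F-complete : ∀ x → Membership._∈_ (CommutativeRing.setoid R) x F) where
  open CommutativeRing R
  open FieldDefs R
  open Membership setoid using (_∈_)
  open SetoidUnique setoid using (Unique)

  Adjacent : Carrier → Carrier → Set
  Adjacent x y = ¬ x ≈ y → U (x * y)

  Adjacent-respˡ : ∀ {x x′ y} → x ≈ x′ → Adjacent x y → Adjacent x′ y
  Adjacent-respˡ x≈x′ adj x′≉y =
    U-resp (*-cong x≈x′ refl) (adj λ x≈y → x′≉y (trans (sym x≈x′) x≈y))

  Adjacent-respʳ : ∀ {x y y′} → y ≈ y′ → Adjacent x y → Adjacent x y′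
  Adjacent-respʳ y≈y′ adj x≉y′ =
    U-resp (*-cong refl y≈y′) (adj λ x≈y → x≉y′ (trans x≈y y≈y′))

  adjacent? : Binary.Decidable Adjacent
  adjacent? x y with x ≟ y | U? (x * y)
  ... | yes x≈y | _        = yes λ x≉y → ⊥-elim (x≉y x≈y)
  ... | no _    | yes Uxy  = yes λ _ → Uxy
  ... | no x≉y  | no ¬Uxy  = no λ adj → ¬Uxy (adj x≉y)

  IsClique? : Decidable (IsClique U)
  IsClique? D = Dec.map′ fromTable toTable
    (AllPairs.allPairs? (λ x y → ¬? (x ≟ y)) D ×-dec All.all? (λ x → All.all? (adjacent? x) D) D)
    where
      fromTable : Unique D × All (λ x → All (Adjacent x) D) D → IsClique U D
      fromTable (D-unique , table) = D-unique , λ a b a∈D b∈D →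
        All.lookupₛ setoid Adjacent-respʳ
          (All.lookupₛ setoid (λ a≈a′ → All.map (Adjacent-respˡ a≈a′)) table a∈D) b∈D

      toTable : IsClique U D → Unique D × All (λ x → All (Adjacent x) D) D
      toTable (D-unique , adjacent) = D-unique ,
        All.tabulateₛ setoid λ a∈D → All.tabulateₛ setoid λ b∈D → adjacent _ _ a∈D b∈D

  maximumClique : List Carrier
  maximumClique = argmax length [] (filter IsClique? (sublists F))

  maximumClique-isClique : IsClique U maximumClique
  maximumClique-isClique = argmax-all length ([] , λ _ _ ()) (All.all-filter IsClique? (sublists F))

  maximumClique-maximum : ∀ D → IsClique U D → length D ℕ.≤ length maximumClique
  maximumClique-maximum D (D-unique , adjacent) =
    ≡.subst (ℕ._≤ length maximumClique) (≡.sym |D|≡|D′|)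
      (All.lookup (f[xs]≤f[argmax] {f = length} [] (filter IsClique? (sublists F)))
        (Prop.∈-filter⁺ IsClique? {xs = sublists F} (filter∈sublists (_∈? D) F) D′-isClique))
    where
      _∈?_ : ∀ x xs → Dec (x ∈ xs)
      x ∈? xs = Any.any? (x ≟_) xs
      D′ : List Carrier
      D′ = filter (_∈? D) F
      D′⊆D : ∀ {x} → x ∈ D′ → x ∈ D
      D′⊆D = proj₂ ∘ MembershipProps.∈-filter⁻ setoid (_∈? D) (MembershipProps.∈-resp-≈ setoid) {xs = F}
      D⊆D′ : ∀ {x} → x ∈ D → x ∈ D′
      D⊆D′ {x} = MembershipProps.∈-filter⁺ setoid (_∈? D) (MembershipProps.∈-resp-≈ setoid) (F-complete x)
      D′-unique : Unique D′
      D′-unique = UniqueProps.filter⁺ setoid (_∈? D) F-unique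
      D′-isClique : IsClique U D′
      D′-isClique = D′-unique , λ a b a∈ b∈ → adjacent a b (D′⊆D a∈) (D′⊆D b∈)
      |D|≡|D′| : length D ≡ length D′
      |D|≡|D′| = UniqueList.Unique-length-≡ setoid D-unique D′-unique D⊆D′ D′⊆D

  maximum⇒maximal : ∀ {C} → IsClique U C → (∀ D → IsClique U D → length D ℕ.≤ length C) →
    IsMaximalClique U C
  maximum⇒maximal {C} C-clique@(C-unique , _) maximum = C-clique , extend
    where
      extend : ∀ C′ → IsClique U C′ → (∀ x → x ∈ C → x ∈ C′) → ∀ x → x ∈ C′ → x ∈ C
      extend C′ (_ , adjacent′) C⊆C′ x x∈C′ with Any.any? (x ≟_) C
      ... | yes x∈C = x∈C
      ... | no x∉C  = ⊥-elim (n≮n (length C) (maximum (x ∷ C) x∷C-isClique))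
        where
          x∷C⊆C′ : ∀ {a} → a ∈ x ∷ C → a ∈ C′
          x∷C⊆C′ (here a≈x)  = MembershipProps.∈-resp-≈ setoid (sym a≈x) x∈C′
          x∷C⊆C′ (there a∈C) = C⊆C′ _ a∈C
          x∷C-isClique : IsClique U (x ∷ C)
          x∷C-isClique = (MembershipProps.∉⇒All[≉] setoid x∉C ∷ C-unique) ,
            λ a b a∈ b∈ → adjacent′ a b (x∷C⊆C′ a∈) (x∷C⊆C′ b∈)

  maximumClique-isMaximal : IsMaximalClique U maximumClique
  maximumClique-isMaximal = maximum⇒maximal maximumClique-isClique maximumClique-maximum

  cliqueNumber : ∀ {ω} → length maximumClique ≡ ω → IsCliqueNumber U ω
  cliqueNumber ≡ω = (maximumClique , maximumClique-isClique , ≡ω) ,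
    λ D D-clique → ≡.subst (length D ℕ.≤_) ≡ω (maximumClique-maximum D D-clique)

module CliqueStructure (R : CommutativeRing 0ℓ 0ℓ) (isField : FieldDefs.IsField R)
                       {S : CommutativeRing.Carrier R → Set} (S-subfield : FieldDefs.IsSubfield R S)
                       {Sl : List (CommutativeRing.Carrier R)}
                       (Sl-unique : SetoidUnique.Unique (CommutativeRing.setoid R) Sl) (Sl⊆S : All S Sl)
                       (S⊆Sl : ∀ x → S x → Membership._∈_ (CommutativeRing.setoid R) x Sl)
                       {U : CommutativeRing.Carrier R → Set} (U-subspace : FieldDefs.IsSubspace R S U)
                       (U? : Decidable U) (_≟_ : Binary.Decidable (CommutativeRing._≈_ R))
                       {Bu : List (CommutativeRing.Carrier R)} (U⊆span : ∀ x → U x → FieldDefs.InSpan R S Bu x)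
                       {C : List (CommutativeRing.Carrier R)} (C-maximal : FieldDefs.IsMaximalClique R U C) where
  open CommutativeRing R
  open FieldDefs R
  open VectorSpace R S-subfield
  open FiniteSpan R S-subfield Sl-unique Sl⊆S S⊆Sl
  open Cliques R S-subfield U-subspace _≟_
  open Membership setoid using (_∈_)
  open SetoidUnique setoid using (Unique)

  C-clique : IsClique U C
  C-clique = proj₁ C-maximal

  module V₂ = Subspace (V₂-isSubspace C-maximal)

  scaled-length-≤ : ∀ {α L} → ¬ α ≈ 0# → LinIndep S L → All (λ γ → U (α * γ)) L →
    length L ℕ.≤ length Bu
  scaled-length-≤ {α} {L} α≉0 ind αL⊆U = ≡.subst (ℕ._≤ length Bu) (length-map (α *_) L)
    (LinIndep-length-≤ (proj₁ isField) (LinIndep-map-* isField α≉0 ind)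
      (All.map⁺ (All.map (U⊆span _) αL⊆U)))

  V₁-length-≤ : ∀ {L} → Unique L → All (V₁ U C) L → length L ℕ.≤ length Bu ℕ.+ 1
  V₁-length-≤ {[]}    _ _ = z≤n
  V₁-length-≤ {β ∷ L} L-unique@(β∉L ∷ _) V₁L@((β∈C , _) ∷ V₁L′) =
    ≡.subst (suc (length L) ℕ.≤_) (ℕₚ.+-comm 1 (length Bu))
      (s≤s (scaled-length-≤ (LinIndep-head-≉0 (proj₁ isField) β∷L-indep) (LinIndep-tail β∷L-indep)
        (clique-adjacent C-clique β∈C β∉L (All.map proj₁ V₁L′))))
    where
      β∷L-indep : LinIndep S (β ∷ L)
      β∷L-indep = V₁-linIndep C-clique L-unique V₁L

  V₁V₂-length-≤ : ∀ {L α B} → Unique L → All (V₁ U C) L →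
    LinIndep S (α ∷ B) → All (V₂ U C) (α ∷ B) → length L ℕ.+ length (α ∷ B) ℕ.≤ length Bu
  V₁V₂-length-≤ {L} {α} {B} L-unique V₁L ind V₂αB@(V₂α ∷ _) =
    ≡.subst (ℕ._≤ length Bu) (length-++ L)
      (scaled-length-≤ (LinIndep-head-≉0 (proj₁ isField) ind) L++αB-indep αL++αB⊆U)
    where
      disjoint : ∀ {x} → InSpan S L x → InSpan S (α ∷ B) x → x ≈ 0#
      disjoint x∈spanL x∈spanαB =
        V₁-span∩V₂≈0 C-clique V₁L x∈spanL (V₂.span⊆ V₂αB x∈spanαB)
      L++αB-indep : LinIndep S (L ++ α ∷ B)
      L++αB-indep = LinIndep-++ (V₁-linIndep C-clique L-unique V₁L) ind disjoint
      αL++αB⊆U : All (λ γ → U (α * γ)) (L ++ α ∷ B)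
      αL++αB⊆U = All.++⁺ (All.map (V₂⇒AdjacentToAll C-clique V₂α ∘ proj₁) V₁L)
                         (All.map (V₂⇒AdjacentToAll C-clique V₂α ∘ proj₁) V₂αB)

  square∈U? : Decidable (λ α → U (α * α))
  square∈U? α = U? (α * α)

  square∈U-resp : Respects (λ α → U (α * α))
  square∈U-resp x≈y = U.resp (*-cong x≈y x≈y)

  C₂ C₁ : List Carrier
  C₂ = filter square∈U? C
  C₁ = filter (¬? ∘ square∈U?) C

  C₂⊆V₂ : All (V₂ U C) C₂
  C₂⊆V₂ = All.tabulateₛ setoid (MembershipProps.∈-filter⁻ setoid square∈U? square∈U-resp)

  C₁⊆V₁ : All (V₁ U C) C₁
  C₁⊆V₁ = All.tabulateₛ setoid
    (MembershipProps.∈-filter⁻ setoid (¬? ∘ square∈U?) (λ x≈y ¬Uxx → ¬Uxx ∘ square∈U-resp (sym x≈y)))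

  C₁-unique : Unique C₁
  C₁-unique = UniqueProps.filter⁺ setoid (¬? ∘ square∈U?) (proj₁ C-clique)

  private
    basis : ∃ λ B → LinIndep S B × All (V₂ U C) B × All (InSpan S B) C₂
    basis = extract-basis _≟_ C₂ C₂⊆V₂

  B : List Carrier
  B = proj₁ basis

  B-linIndep : LinIndep S B
  B-linIndep = proj₁ (proj₂ basis)

  B⊆V₂ : All (V₂ U C) B
  B⊆V₂ = proj₁ (proj₂ (proj₂ basis))

  C₂⊆span : All (InSpan S B) C₂
  C₂⊆span = proj₂ (proj₂ (proj₂ basis))

  t r : ℕ
  t = length B
  r = length C₁

  length-C₂ : length C₂ ≡ length Sl ℕ.^ t
  length-C₂ = ≡.trans
    (UniqueList.Unique-length-≡ setoid C₂-unique (spanList-unique B-linIndep) C₂⊆spanList spanList⊆C₂)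
    (length-spanList B)
    where
      C₂-unique : Unique C₂
      C₂-unique = UniqueProps.filter⁺ setoid square∈U? (proj₁ C-clique)
      C₂⊆spanList : ∀ {x} → x ∈ C₂ → x ∈ spanList B
      C₂⊆spanList x∈C₂ = ∈-spanList⁺ B (All.lookupₛ setoid InSpan-resp C₂⊆span x∈C₂)
      spanList⊆C₂ : ∀ {x} → x ∈ spanList B → x ∈ C₂
      spanList⊆C₂ x∈ with V₂.span⊆ B⊆V₂ (∈-spanList⁻ B x∈)
      ... | x∈C , Uxx = MembershipProps.∈-filter⁺ setoid square∈U? square∈U-resp x∈C Uxx

  length-C : length C ≡ length Sl ℕ.^ t ℕ.+ r
  length-C = ≡.trans (length-filter-partition square∈U? C) (≡.cong (ℕ._+ r) length-C₂)

  t-r-bounds : (t ≡ 0 × r ℕ.≤ length Bu ℕ.+ 1) ⊎ (1 ℕ.≤ t × r ℕ.+ t ℕ.≤ length Bu)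
  t-r-bounds = bounds B-linIndep B⊆V₂
    where
      bounds : ∀ {B} → LinIndep S B → All (V₂ U C) B →
        (length B ≡ 0 × r ℕ.≤ length Bu ℕ.+ 1) ⊎ (1 ℕ.≤ length B × r ℕ.+ length B ℕ.≤ length Bu)
      bounds {[]}    _   _   = inj₁ (≡.refl , V₁-length-≤ C₁-unique C₁⊆V₁)
      bounds {_ ∷ _} ind V₂B = inj₂ (s≤s z≤n , V₁V₂-length-≤ C₁-unique C₁⊆V₁ ind V₂B)

-- Opened only now: in the modules above they would clash with the ring operations.
open import Data.Nat using (_^_; _≤_; _+_)

theorem3p1 : (q n : ℕ) → IsPrimePower q → 2 ≤ n →
    (R : CommutativeRing 0ℓ 0ℓ) →
    FieldDefs.IsField R → FieldDefs.HasSize R (λ _ → ⊤) (q ^ n) →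
    (S : CommutativeRing.Carrier R → Set) → FieldDefs.IsSubfield R S → FieldDefs.HasSize R S q →
    (U : CommutativeRing.Carrier R → Set) → FieldDefs.IsSubspace R S U → (∃ λ x → ¬ U x) →
    (d : ℕ) → FieldDefs.HasDim R S U d → 1 ≤ d →
    (∀ (C : List (CommutativeRing.Carrier R)) → FieldDefs.IsMaximalClique R U C →
       FieldDefs.IsSubspace R S (FieldDefs.V₂ R U C)
       × (∀ (L : List (CommutativeRing.Carrier R)) →
            SetoidUnique.Unique (CommutativeRing.setoid R) L →
            All (FieldDefs.V₁ R U C) L → FieldDefs.LinIndep R S L)
       × ((∃ λ α → FieldDefs.V₁ R U C α) → ∀ x → FieldDefs.V₂ R U C x →
            (∃ λ (L : List (CommutativeRing.Carrier R)) →
               All (FieldDefs.V₁ R U C) L × FieldDefs.InSpan R S L x) →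
            CommutativeRing._≈_ R x (CommutativeRing.0# R)))
    × (∃ λ t → ∃ λ r → FieldDefs.IsCliqueNumber R U (q ^ t + r)
         × ((t ≡ 0 × r ≤ d + 1) ⊎ (1 ≤ t × r + t ≤ d)))
theorem3p1 _ _ _ _ R isField (F , _ , F-unique , _ , F-complete)
           S S-subfield (Sl , ≡.refl , Sl-unique , Sl⊆S , S⊆Sl)
           U U-subspace _ _ (Bu , ≡.refl , Bu⊆U , _ , U⊆span) _ =
    (λ C C-maximal →
         V₂-isSubspace C-maximal
       , (λ _ → V₁-linIndep (proj₁ C-maximal))
       , λ { _ _ V₂x (_ , V₁L , x∈span) → V₁-span∩V₂≈0 (proj₁ C-maximal) V₁L x∈span V₂x })
  , t , r , cliqueNumber length-C , t-r-bounds
  where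
    open CommutativeRing R using (setoid)
    F-complete′ : ∀ x → Membership._∈_ setoid x F
    F-complete′ x = F-complete x tt
    _≟_ : Binary.Decidable (CommutativeRing._≈_ R)
    _≟_ = UniqueList.enumeration⇒≈-decidable setoid F-unique F-complete′
    U? : Decidable U
    U? = FiniteSpan.spanned-decidable R S-subfield Sl-unique Sl⊆S S⊆Sl _≟_ U-subspace Bu⊆U U⊆span
    open Cliques R S-subfield U-subspace _≟_
    open MaximumClique R (proj₁ U-subspace) U? _≟_ F-unique F-complete′
    open CliqueStructure R isField S-subfield Sl-unique Sl⊆S S⊆Sl U-subspace U? _≟_ U⊆span
                         maximumClique-isMaximal
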